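{- If $\lambda$ is a wide partition with $\ell(\lambda)$ parts, then $\lambda_{\ell(\lambda)-i}>i$ for every integer $i$ with $0\le i\le\ell(\lambda)-1$.
   Context: For partitions $\alpha,\beta$ of the same integer, $\alpha\ge\beta$ (dominance) means $\sum_{k\le j}\alpha_k\ge\sum_{k\le j}\beta_k$ for all $j$; $\nu'$ is the conjugate of $\nu$. $\nu$ is a subpartition of $\lambda$ if the multiset of parts of $\nu$ is a submultiset of that of $\lambda$. $\lambda$ is wide if $\nu\ge\nu'$ for every subpartition $\nu$ of $\lambda$. $\ell(\lambda)$ is the number of parts of $\lambda$. -}

module Defs where

open import Data.Nat using (ℕ; zero; suc; _≤_; _<_; _≥_; _≤?_)
open import Data.Nat.ListAction using (sum)
open import Data.Product using (_×_)
open import Data.List using (List; []; _∷_; take; filter; length; applyUpTo)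
open import Data.List.Relation.Unary.All using (All)
open import Data.List.Relation.Unary.Linked using (Linked)
open import Data.List.Relation.Binary.Sublist.Propositional using (_⊆_)

IsPartition : List ℕ → Set
IsPartition xs = Linked _≥_ xs × All (0 <_) xs

largest : List ℕ → ℕ
largest []      = 0
largest (x ∷ _) = x

-- Conjugate: ν'_k = #{ i : ν_i ≥ k } for k = 1, …, ν_1.
conj : List ℕ → List ℕ
conj ν = applyUpTo (λ k → length (filter (suc k ≤?_) ν)) (largest ν)

-- Dominance α ≥ β: every prefix sum of α is at least that of β.
-- (Used only for α, β partitions of the same integer.)
Dominates : List ℕ → List ℕ → Set
Dominates α β = ∀ j → sum (take j β) ≤ sum (take j α)

-- ν is a subpartition of λ: its multiset of parts is a submultiset of λ's.
-- For weakly decreasing lists this is exactly being a sublist.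
Subpartition : List ℕ → List ℕ → Set
Subpartition ν lam = ν ⊆ lam

Wide : List ℕ → Set
Wide lam = ∀ ν → Subpartition ν lam → Dominates ν (conj ν)

-- 1-indexed part λ_k (0 if out of range).
part : List ℕ → ℕ → ℕ
part []       _             = 0
part (x ∷ _)  1             = x
part (_ ∷ xs) (suc (suc k)) = part xs (suc k)
part (_ ∷ _)  zero          = 0

{-# OPTIONS --safe #-}
-- The last i + 1 parts of λ form a subpartition ν with ℓ(ν) = i + 1 and
-- largest part ν₁ = λ_{ℓ(λ)-i}.  Since ν'₁ = ℓ(ν), the first prefix-sum
-- inequality of ν ≥ ν' already gives λ_{ℓ(λ)-i} = ν₁ ≥ ℓ(ν) = i + 1.
module Submission where

open import Defs
open import Data.Nat using (ℕ; zero; suc; _<_; _≤_; _∸_; _≤?_; s≤s)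
open import Data.Nat.Properties using (+-identityʳ; +-∸-assoc; m∸[m∸n]≡n; module ≤-Reasoning)
open import Data.Nat.ListAction using (sum)
open import Data.List using (List; []; _∷_; length; drop; take)
open import Data.List.Properties using (length-drop; filter-all)
open import Data.List.Relation.Unary.All using (All; _∷_)
open import Data.List.Relation.Unary.All.Properties using (drop⁺)
open import Data.List.Relation.Binary.Sublist.Propositional.Properties using (drop-⊆)
open import Data.Product using (_,_)
open import Relation.Binary.PropositionalEquality using (_≡_; refl; cong; trans)

sum-take-1 : (xs : List ℕ) → sum (take 1 xs) ≡ largest xs
sum-take-1 []      = refl
sum-take-1 (x ∷ _) = +-identityʳ x

largest-conj : (ν : List ℕ) → All (0 <_) ν → largest (conj ν) ≡ length ν
largest-conj []      _                 = refl
largest-conj (_ ∷ _) pos@(s≤s _ ∷ _) = cong length (filter-all (1 ≤?_) pos)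

length≤largest : (ν : List ℕ) → All (0 <_) ν → Dominates ν (conj ν) →
                 length ν ≤ largest ν
length≤largest ν pos ν≥ν′ = begin
  length ν                ≡⟨ largest-conj ν pos ⟨
  largest (conj ν)        ≡⟨ sum-take-1 (conj ν) ⟨
  sum (take 1 (conj ν))   ≤⟨ ν≥ν′ 1 ⟩
  sum (take 1 ν)          ≡⟨ sum-take-1 ν ⟩
  largest ν               ∎
  where open ≤-Reasoning

part-suc : (k : ℕ) (xs : List ℕ) → part xs (suc k) ≡ largest (drop k xs)
part-suc zero    []       = refl
part-suc zero    (_ ∷ _)  = refl
part-suc (suc k) []       = refl
part-suc (suc k) (_ ∷ xs) = part-suc k xs

m∸n≡1+[m∸1+n] : ∀ {m n} → n < m → m ∸ n ≡ suc (m ∸ suc n)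
m∸n≡1+[m∸1+n] {suc m} (s≤s n≤m) = +-∸-assoc 1 n≤m

lemma1 : (lam : List ℕ) → IsPartition lam → Wide lam →
    (i : ℕ) → i < length lam → i < part lam (length lam ∸ i)
lemma1 lam (_ , pos) wide i i<ℓ = begin
  suc i                       ≡⟨ trans (length-drop k lam) (m∸[m∸n]≡n i<ℓ) ⟨
  length tail                 ≤⟨ length≤largest tail (drop⁺ k pos) (wide tail (drop-⊆ k lam)) ⟩
  largest tail                ≡⟨ part-suc k lam ⟨
  part lam (suc k)            ≡⟨ cong (part lam) (m∸n≡1+[m∸1+n] i<ℓ) ⟨
  part lam (length lam ∸ i)   ∎
  where
  open ≤-Reasoning
  k : ℕ
  k = length lam ∸ suc i
  tail : List ℕ
  tail = drop k lam
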